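{- For integers $D,m$ with $m>D\ge 1$ and for every $\varepsilon>0$ there is a $D\times m$ matrix $M$ with entries $a(i,j)$ such that: (1) every $a(i,j)$ is an integer with $a(i,j)\ge 1$, $a(i,j+1)>a(i,j)$ for all $i\in[D]$, $j\in[m-1]$, and $a(i+1,1)>a(i,m)$ for all $i\in[D-1]$; (2) for every $k\in\{2,\ldots,D\}$ and every $k\times k$ submatrix $M^*$ of $M$ (rows $i_1<\dots<i_k$, columns $j_1<\dots<j_k$), with $P=\prod_{l=1}^k a(i_l,j_l)$ the product of the entries on the main diagonal of $M^*$, one has $|\det M^*-P|<\varepsilon P$; (3) $a(i,j-1)\,a(i,j)<\varepsilon\, a(i,j+1)$ for all $i\in[D]$ and $j\in\{2,\ldots,m-1\}$.
   Formalization: The parameter ε ranges over the positive rationals. -}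

module Defs where

open import Data.Nat as ℕ using (ℕ; zero; suc)
open import Data.Integer as ℤ using (ℤ)
open import Data.Fin using (Fin; zero; suc; punchIn)
open import Data.Rational as ℚ using (ℚ)
open import Function using (_∘_)

toℚ : ℤ → ℚ
toℚ z = z ℚ./ 1

ℕtoℚ : ℕ → ℚ
ℕtoℚ n = toℚ (ℤ.+ n)

altSum : ∀ {n} → (Fin n → ℤ) → ℤ
altSum {zero}  f = ℤ.0ℤ
altSum {suc n} f = f zero ℤ.- altSum (f ∘ suc)

minor : ∀ {k} → (Fin (suc k) → Fin (suc k) → ℤ) → Fin (suc k) → Fin k → Fin k → ℤ
minor A j r c = A (suc r) (punchIn j c)

det : ∀ {k} → (Fin k → Fin k → ℤ) → ℤ
det {zero}  A = ℤ.1ℤ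
det {suc k} A = altSum (λ j → A zero j ℤ.* det (minor A j))

prodFin : ∀ {k} → (Fin k → ℕ) → ℕ
prodFin {zero}  f = 1
prodFin {suc k} f = f zero ℕ.* prodFin (f ∘ suc)

StrictInc : ∀ {k} → (Fin k → ℕ) → Set
StrictInc {k} s = ∀ (a b : Fin k) → a Data.Fin.< b → s a ℕ.< s b
  where import Data.Fin

-- Call a matrix of naturals x-dominant if for every 2×2 submatrix the
-- diagonal product is at least x times the antidiagonal one. Expanding the
-- determinant along the first row, every term other than the diagonal one is
-- at most 2/x times the diagonal product (the 1/x comes from the dominance of
-- the top-left 2×2 block, the 2 from the inductive bound on the minor), so
-- induction on k gives
-- x · |det A − P| ≤ k(k − 1) · P for a k×k x-dominant matrix with diagonal
-- product P. The matrix a(i,j) = x ^ (G^i · 2^j) is x-dominant because the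
-- exponents G^i · 2^j form a strictly supermodular array of integers; doubling
-- in j gives property (3), and G > 2^m makes the rows increase across row
-- boundaries. Taking x large compared to the denominator of ε finishes.
module Submission where

open import Defs
open import Data.Nat using (ℕ; _≤_; _<_; suc; _∸_)
open import Data.Integer using (+_)
open import Data.Fin using (Fin)
open import Data.Product using (Σ; _×_)
open import Data.Rational using (ℚ; 0ℚ; _-_; ∣_∣) renaming (_<_ to _<ℚ_; _*_ to _*ℚ_)

import Data.Nat
open import Data.Nat using (zero; _+_; _*_; _^_; z≤n; s≤s; NonZero; >-nonZero)
open import Data.Nat.Properties
open import Data.Nat.Tactic.RingSolver using (solve-∀)
open import Data.Integer as ℤ using (ℤ; +[1+_]; -[1+_])
import Data.Integer.Properties as ℤP
import Data.Integer.Tactic.RingSolver as ℤ-Solver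
open import Data.Fin as Fin using (zero; suc; punchIn)
import Data.Fin.Properties as FinP
open import Data.Product using (_,_)
open import Data.Rational as ℚ using (mkℚ; ↧ₙ_; toℚᵘ)
import Data.Rational.Properties as ℚP
open import Data.Rational.Unnormalised as ℚᵘ using (mkℚᵘ; *≡*; *<*)
import Data.Rational.Unnormalised.Properties as ℚᵘP
open import Function using (_∘_)
open import Relation.Binary.Core using (_Preserves_⟶_)
open import Relation.Binary.PropositionalEquality

Matrix : ℕ → Set
Matrix k = Fin k → Fin k → ℕ

diag : ∀ {k} → Matrix k → ℕ
diag A = prodFin (λ l → A l l)

minorℕ : ∀ {k} → Matrix (suc k) → Fin (suc k) → Matrix k
minorℕ A j r c = A (suc r) (punchIn j c)

detℕ : ∀ {k} → Matrix k → ℤ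
detℕ A = det (λ r c → + A r c)

Dominant : ℕ → ∀ {k} → Matrix k → Set
Dominant x A = ∀ {a a' b b'} → a Fin.< a' → b Fin.< b' →
  A a b' * A a' b * x ≤ A a b * A a' b'

punchIn-mono-< : ∀ {n} (i : Fin (suc n)) → punchIn i Preserves Fin._<_ ⟶ Fin._<_
punchIn-mono-< i {j} {k} j<k =
  FinP.≤∧≢⇒< (FinP.punchIn-mono-≤ i j k (<⇒≤ j<k))
             (λ eq → FinP.<-irrefl (FinP.punchIn-injective i j k eq) j<k)

Dominant-submatrix : ∀ {x k n} (A : Matrix n) {f g : Fin k → Fin n} →
  f Preserves Fin._<_ ⟶ Fin._<_ → g Preserves Fin._<_ ⟶ Fin._<_ →
  Dominant x A → Dominant x (λ a b → A (f a) (g b))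
Dominant-submatrix A f-mono g-mono dom a<a' b<b' = dom (f-mono a<a') (g-mono b<b')

Dominant-minor : ∀ {x k} (A : Matrix (suc k)) j → Dominant x A → Dominant x (minorℕ A j)
Dominant-minor A j = Dominant-submatrix A s≤s (punchIn-mono-< j)

-- slack k = k (k − 1)
slack : ℕ → ℕ
slack zero    = 0
slack (suc k) = slack k + 2 * k

slack-mono : ∀ {m n} → m ≤ n → slack m ≤ slack n
slack-mono {zero}              _       = z≤n
slack-mono {suc m} {suc n} (s≤s m≤n) = +-mono-≤ (slack-mono m≤n) (*-monoʳ-≤ 2 m≤n)

altSum-bound : ∀ {n} y (f : Fin n → ℤ) c → (∀ j → y * ℤ.∣ f j ∣ ≤ c) →
  y * ℤ.∣ altSum f ∣ ≤ n * c
altSum-bound {zero}  y f c _     = ≤-reflexive (*-zeroʳ y)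
altSum-bound {suc n} y f c bound = begin
  y * ℤ.∣ f zero ℤ.- altSum (f ∘ suc) ∣            ≤⟨ *-monoʳ-≤ y (ℤP.∣i-j∣≤∣i∣+∣j∣ (f zero) (altSum (f ∘ suc))) ⟩
  y * (ℤ.∣ f zero ∣ + ℤ.∣ altSum (f ∘ suc) ∣)      ≡⟨ *-distribˡ-+ y _ _ ⟩
  y * ℤ.∣ f zero ∣ + y * ℤ.∣ altSum (f ∘ suc) ∣    ≤⟨ +-mono-≤ (bound zero) (altSum-bound y (f ∘ suc) c (bound ∘ suc)) ⟩
  c + n * c                                       ∎
  where open ≤-Reasoning

close⇒∣i∣≤2*n : ∀ x .{{_ : NonZero x}} e (i : ℤ) n →
  x * ℤ.∣ i ℤ.- + n ∣ ≤ e * n → e ≤ x → ℤ.∣ i ∣ ≤ 2 * n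
close⇒∣i∣≤2*n x e i n close e≤x = *-cancelˡ-≤ x (begin
  x * ℤ.∣ i ∣                    ≡⟨ cong (λ z → x * ℤ.∣ z ∣) (minus-plus i (+ n)) ⟨
  x * ℤ.∣ (i ℤ.- + n) ℤ.+ + n ∣  ≤⟨ *-monoʳ-≤ x (ℤP.∣i+j∣≤∣i∣+∣j∣ (i ℤ.- + n) (+ n)) ⟩
  x * (ℤ.∣ i ℤ.- + n ∣ + n)      ≡⟨ *-distribˡ-+ x _ n ⟩
  x * ℤ.∣ i ℤ.- + n ∣ + x * n    ≤⟨ +-monoˡ-≤ (x * n) (≤-trans close (*-monoˡ-≤ n e≤x)) ⟩
  x * n + x * n                  ≡⟨ double x n ⟩
  x * (2 * n)                    ∎)
  where
    open ≤-Reasoning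
    minus-plus : ∀ i j → (i ℤ.- j) ℤ.+ j ≡ i
    minus-plus = ℤ-Solver.solve-∀
    double : ∀ x n → x * n + x * n ≡ x * (2 * n)
    double = solve-∀

∣[ad-s]-ap∣≤a∣d-p∣+∣s∣ : ∀ a d s p →
  ℤ.∣ (+ a ℤ.* d ℤ.- s) ℤ.- + (a * p) ∣ ≤ a * ℤ.∣ d ℤ.- + p ∣ + ℤ.∣ s ∣
∣[ad-s]-ap∣≤a∣d-p∣+∣s∣ a d s p = begin
  ℤ.∣ (+ a ℤ.* d ℤ.- s) ℤ.- + (a * p) ∣        ≡⟨ cong ℤ.∣_∣ split ⟩
  ℤ.∣ + a ℤ.* (d ℤ.- + p) ℤ.- s ∣              ≤⟨ ℤP.∣i-j∣≤∣i∣+∣j∣ (+ a ℤ.* (d ℤ.- + p)) s ⟩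
  ℤ.∣ + a ℤ.* (d ℤ.- + p) ∣ + ℤ.∣ s ∣          ≡⟨ cong (_+ ℤ.∣ s ∣) (ℤP.abs-* (+ a) (d ℤ.- + p)) ⟩
  a * ℤ.∣ d ℤ.- + p ∣ + ℤ.∣ s ∣                ∎
  where
    open ≤-Reasoning
    regroup : ∀ a d s p → (a ℤ.* d ℤ.- s) ℤ.- a ℤ.* p ≡ a ℤ.* (d ℤ.- p) ℤ.- s
    regroup = ℤ-Solver.solve-∀
    split : (+ a ℤ.* d ℤ.- s) ℤ.- + (a * p) ≡ + a ℤ.* (d ℤ.- + p) ℤ.- s
    split = trans (cong (λ q → (+ a ℤ.* d ℤ.- s) ℤ.- q) (ℤP.pos-* a p)) (regroup (+ a) d s (+ p))

module _ {x : ℕ} .{{_ : NonZero x}} where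

  diag-minor-≤ : ∀ {k} (A : Matrix (suc k)) → Dominant x A → ∀ j →
    A zero j * diag (minorℕ A j) ≤ diag A
  diag-minor-suc : ∀ {k} (A : Matrix (suc k)) → Dominant x A → ∀ j →
    A zero (suc j) * diag (minorℕ A (suc j)) * x ≤ diag A

  diag-minor-≤ A dom zero = ≤-refl
  diag-minor-≤ {suc k} A dom (suc j) = ≤-trans (m≤m*n _ x) (diag-minor-suc A dom j)

  -- B drops row 1 and column 0 of A, so minor j of B is minor (j + 1) of A
  -- without its first diagonal entry A 1 0.
  diag-minor-suc {suc k} A dom j = begin
    c * (a₁₀ * Q) * x     ≡⟨ swap c a₁₀ Q x ⟩
    (c * Q) * (a₁₀ * x)   ≤⟨ *-monoˡ-≤ (a₁₀ * x) (diag-minor-≤ B domB j) ⟩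
    (a₀₁ * R) * (a₁₀ * x) ≡⟨ regroup a₀₁ R a₁₀ x ⟩
    (a₀₁ * a₁₀ * x) * R   ≤⟨ *-monoˡ-≤ R (dom {zero} {suc zero} {zero} {suc zero} (s≤s z≤n) (s≤s z≤n)) ⟩
    (a₀₀ * a₁₁) * R       ≡⟨ *-assoc a₀₀ a₁₁ R ⟩
    diag A                ∎
    where
      open ≤-Reasoning
      B : Matrix (suc k)
      B r c = A (punchIn (suc zero) r) (suc c)
      domB : Dominant x B
      domB = Dominant-submatrix A (punchIn-mono-< (suc zero)) s≤s dom
      c = A zero (suc j)
      a₀₀ = A zero zero
      a₀₁ = A zero (suc zero)
      a₁₀ = A (suc zero) zero
      a₁₁ = A (suc zero) (suc zero)
      Q = diag (minorℕ B j)
      R = prodFin (λ l → A (suc (suc l)) (suc (suc l)))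
      swap : ∀ a b c d → a * (b * c) * d ≡ (a * c) * (b * d)
      swap = solve-∀
      regroup : ∀ a b c d → (a * b) * (c * d) ≡ (a * c * d) * b
      regroup = solve-∀

  off-diag-term-≤ : ∀ {k} (A : Matrix (suc k)) → Dominant x A → ∀ j →
    ℤ.∣ detℕ (minorℕ A (suc j)) ∣ ≤ 2 * diag (minorℕ A (suc j)) →
    x * ℤ.∣ + A zero (suc j) ℤ.* detℕ (minorℕ A (suc j)) ∣ ≤ 2 * diag A
  off-diag-term-≤ A dom j ∣d∣≤2P = begin
    x * ℤ.∣ + c ℤ.* d ∣  ≡⟨ cong (x *_) (ℤP.abs-* (+ c) d) ⟩
    x * (c * ℤ.∣ d ∣)    ≤⟨ *-monoʳ-≤ x (*-monoʳ-≤ c ∣d∣≤2P) ⟩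
    x * (c * (2 * P))    ≡⟨ shuffle x c P ⟩
    2 * (c * P * x)      ≤⟨ *-monoʳ-≤ 2 (diag-minor-suc A dom j) ⟩
    2 * diag A           ∎
    where
      open ≤-Reasoning
      c = A zero (suc j)
      d = detℕ (minorℕ A (suc j))
      P = diag (minorℕ A (suc j))
      shuffle : ∀ x c p → x * (c * (2 * p)) ≡ 2 * (c * p * x)
      shuffle = solve-∀

det-near-diag : ∀ {x} .{{_ : NonZero x}} {k} (A : Matrix k) → Dominant x A → slack k ≤ x →
  x * ℤ.∣ detℕ A ℤ.- + diag A ∣ ≤ slack k * diag A
det-near-diag {x} {k = zero}  A _   _       = ≤-reflexive (*-zeroʳ x)
det-near-diag {x} {k = suc k} A dom slack≤x = begin
  x * ℤ.∣ (+ a ℤ.* d₀ ℤ.- S) ℤ.- + (a * P₀) ∣  ≤⟨ *-monoʳ-≤ x (∣[ad-s]-ap∣≤a∣d-p∣+∣s∣ a d₀ S P₀) ⟩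
  x * (a * ℤ.∣ d₀ ℤ.- + P₀ ∣ + ℤ.∣ S ∣)        ≡⟨ distribute x a ℤ.∣ d₀ ℤ.- + P₀ ∣ ℤ.∣ S ∣ ⟩
  a * (x * ℤ.∣ d₀ ℤ.- + P₀ ∣) + x * ℤ.∣ S ∣    ≤⟨ +-mono-≤ (*-monoʳ-≤ a (minor-bound zero)) (altSum-bound x _ _ term-bound) ⟩
  a * (slack k * P₀) + k * (2 * (a * P₀))      ≡⟨ collect a (slack k) P₀ k ⟩
  (slack k + 2 * k) * (a * P₀)                 ∎
  where
    open ≤-Reasoning
    a  = A zero zero
    d₀ = detℕ (minorℕ A zero)
    P₀ = diag (minorℕ A zero)
    S  = altSum (λ j → + A zero (suc j) ℤ.* detℕ (minorℕ A (suc j)))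
    slack≤x′ : slack k ≤ x
    slack≤x′ = ≤-trans (m≤m+n (slack k) (2 * k)) slack≤x
    minor-bound : ∀ j → x * ℤ.∣ detℕ (minorℕ A j) ℤ.- + diag (minorℕ A j) ∣ ≤ slack k * diag (minorℕ A j)
    minor-bound j = det-near-diag (minorℕ A j) (Dominant-minor A j dom) slack≤x′
    term-bound : ∀ j → x * ℤ.∣ + A zero (suc j) ℤ.* detℕ (minorℕ A (suc j)) ∣ ≤ 2 * diag A
    term-bound j = off-diag-term-≤ A dom j
      (close⇒∣i∣≤2*n x (slack k) (detℕ (minorℕ A (suc j))) (diag (minorℕ A (suc j))) (minor-bound (suc j)) slack≤x′)
    distribute : ∀ x a u s → x * (a * u + s) ≡ a * (x * u) + x * s
    distribute = solve-∀
    collect : ∀ a e p k → a * (e * p) + k * (2 * (a * p)) ≡ (e + 2 * k) * (a * p)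
    collect = solve-∀

det-relative-error : ∀ {x} .{{_ : NonZero x}} {k} (A : Matrix k) → Dominant x A →
  ∀ q .{{_ : NonZero q}} → q * slack k < x → .{{NonZero (diag A)}} →
  q * ℤ.∣ detℕ A ℤ.- + diag A ∣ < diag A
det-relative-error {x} {k = k} A dom q q*slack<x = *-cancelˡ-< x _ _ (begin-strict
  x * (q * u)        ≡⟨ x*[q*u]≡q*[x*u] x q u ⟩
  q * (x * u)        ≤⟨ *-monoʳ-≤ q (det-near-diag A dom slack≤x) ⟩
  q * (slack k * P)  ≡⟨ *-assoc q (slack k) P ⟨
  q * slack k * P    <⟨ *-monoˡ-< P q*slack<x ⟩
  x * P              ∎)
  where
    open ≤-Reasoning
    P = diag A
    u = ℤ.∣ detℕ A ℤ.- + P ∣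
    slack≤x : slack k ≤ x
    slack≤x = ≤-trans (m≤n*m (slack k) q) (<⇒≤ q*slack<x)
    x*[q*u]≡q*[x*u] : ∀ x q u → x * (q * u) ≡ q * (x * u)
    x*[q*u]≡q*[x*u] = solve-∀

∣toℚ-ℕtoℚ∣≡ℕtoℚ∣-∣ : ∀ w n → ∣ toℚ w - ℕtoℚ n ∣ ≡ ℕtoℚ ℤ.∣ w ℤ.- + n ∣
∣toℚ-ℕtoℚ∣≡ℕtoℚ∣-∣ w n = ℚP.toℚᵘ-injective (begin
  toℚᵘ ∣ toℚ w - ℕtoℚ n ∣                      ≈⟨ ℚP.toℚᵘ-homo-∣-∣ (toℚ w - ℕtoℚ n) ⟩
  ℚᵘ.∣ toℚᵘ (toℚ w - ℕtoℚ n) ∣                 ≈⟨ ℚᵘP.∣-∣-cong difference ⟩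
  mkℚᵘ (+ ℤ.∣ w ℤ.- + n ∣) 0                   ≈⟨ ℚP.toℚᵘ-fromℚᵘ (mkℚᵘ (+ ℤ.∣ w ℤ.- + n ∣) 0) ⟨
  toℚᵘ (ℕtoℚ ℤ.∣ w ℤ.- + n ∣)                  ∎)
  where
    open ℚᵘP.≃-Reasoning
    subtract : ∀ w n → (w ℤ.* + 1 ℤ.+ ℤ.- n ℤ.* + 1) ℤ.* + 1 ≡ (w ℤ.- n) ℤ.* + 1
    subtract = ℤ-Solver.solve-∀
    difference : toℚᵘ (toℚ w - ℕtoℚ n) ℚᵘ.≃ mkℚᵘ (w ℤ.- + n) 0
    difference = begin
      toℚᵘ (toℚ w - ℕtoℚ n)                  ≈⟨ ℚP.toℚᵘ-homo-+ (toℚ w) (ℚ.- ℕtoℚ n) ⟩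
      toℚᵘ (toℚ w) ℚᵘ.+ toℚᵘ (ℚ.- ℕtoℚ n)    ≈⟨ ℚᵘP.+-cong (ℚP.toℚᵘ-fromℚᵘ (mkℚᵘ w 0))
                                                   (ℚᵘP.≃-trans (ℚP.toℚᵘ-homo‿- (ℕtoℚ n))
                                                                (ℚᵘP.-‿cong (ℚP.toℚᵘ-fromℚᵘ (mkℚᵘ (+ n) 0)))) ⟩
      mkℚᵘ w 0 ℚᵘ.+ ℚᵘ.- mkℚᵘ (+ n) 0         ≈⟨ *≡* (subtract w (+ n)) ⟩
      mkℚᵘ (w ℤ.- + n) 0                     ∎

-- ε ≥ 1 / ↧ₙ ε, read off by cross-multiplying in ℚᵘ.
↧ₙ*a<b⇒a<ε*b : ∀ ε → 0ℚ <ℚ ε → ∀ a b → ↧ₙ ε * a < b → ℕtoℚ a <ℚ ε *ℚ ℕtoℚ b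
↧ₙ*a<b⇒a<ε*b ε@(mkℚ +[1+ n ] d _) _ a b q*a<b =
  ℚP.toℚᵘ-cancel-< (ℚᵘP.<-respˡ-≃ (ℚᵘP.≃-sym (ℚP.toℚᵘ-fromℚᵘ (mkℚᵘ (+ a) 0)))
                     (ℚᵘP.<-respʳ-≃ (ℚᵘP.≃-sym product) (*<* (subst₂ ℤ._<_ (sym lhs) (sym rhs) (ℤ.+<+ a*q<[1+n]*b)))))
  where
    product : toℚᵘ (ε *ℚ ℕtoℚ b) ℚᵘ.≃ mkℚᵘ +[1+ n ] d ℚᵘ.* mkℚᵘ (+ b) 0
    product = ℚᵘP.≃-trans (ℚP.toℚᵘ-homo-* ε (ℕtoℚ b))
                          (ℚᵘP.*-congˡ {mkℚᵘ +[1+ n ] d} (ℚP.toℚᵘ-fromℚᵘ (mkℚᵘ (+ b) 0)))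
    lhs : + a ℤ.* + suc (d * 1) ≡ + (a * suc d)
    lhs = trans (sym (ℤP.pos-* a (suc (d * 1)))) (cong (λ z → + (a * suc z)) (*-identityʳ d))
    rhs : (+[1+ n ] ℤ.* + b) ℤ.* + 1 ≡ + (suc n * b)
    rhs = trans (ℤP.*-identityʳ _) (sym (ℤP.pos-* (suc n) b))
    a*q<[1+n]*b : a * suc d < suc n * b
    a*q<[1+n]*b = ≤-trans (≤-reflexive (cong suc (*-comm a (suc d)))) (≤-trans q*a<b (m≤n*m b (suc n)))
↧ₙ*a<b⇒a<ε*b (mkℚ (+ 0)     _ _) (ℚ.*<* (ℤ.+<+ ()))
↧ₙ*a<b⇒a<ε*b (mkℚ -[1+ _ ] _ _) (ℚ.*<* ())

a*x≤b⇒a<ε*b : ∀ ε → 0ℚ <ℚ ε → ∀ {x a b} → ↧ₙ ε < x → 1 ≤ a → a * x ≤ b → ℕtoℚ a <ℚ ε *ℚ ℕtoℚ b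
a*x≤b⇒a<ε*b ε ε>0 {x} {a} {b} q<x a≥1 a*x≤b = ↧ₙ*a<b⇒a<ε*b ε ε>0 a b (begin-strict
  ↧ₙ ε * a  <⟨ *-monoˡ-< a {{>-nonZero a≥1}} q<x ⟩
  x * a     ≡⟨ *-comm x a ⟩
  a * x     ≤⟨ a*x≤b ⟩
  b         ∎)
  where open ≤-Reasoning

prodFin-pos : ∀ {k} (f : Fin k → ℕ) → (∀ l → 1 ≤ f l) → 1 ≤ prodFin f
prodFin-pos {zero}  f pos = ≤-refl
prodFin-pos {suc k} f pos = *-mono-≤ (pos zero) (prodFin-pos (f ∘ suc) (pos ∘ suc))

det-near-diag-ℚ : ∀ ε → 0ℚ <ℚ ε → ∀ {x} .{{_ : NonZero x}} {k} (A : Matrix k) → Dominant x A →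
  ↧ₙ ε * slack k < x → (∀ l → 1 ≤ A l l) →
  ∣ toℚ (detℕ A) - ℕtoℚ (diag A) ∣ <ℚ ε *ℚ ℕtoℚ (diag A)
det-near-diag-ℚ ε ε>0 A dom q*slack<x pos =
  subst (_<ℚ ε *ℚ ℕtoℚ (diag A)) (sym (∣toℚ-ℕtoℚ∣≡ℕtoℚ∣-∣ (detℕ A) (diag A)))
    (↧ₙ*a<b⇒a<ε*b ε ε>0 _ _
      (det-relative-error A dom (↧ₙ ε) q*slack<x {{>-nonZero (prodFin-pos (λ l → A l l) pos)}}))

rearrangement-< : ∀ {a a' b b'} → a < a' → b < b' → a * b' + a' * b < a * b + a' * b'
rearrangement-< {a} {b = b} a<a' b<b' with m≤n⇒∃[o]m+o≡n a<a' | m≤n⇒∃[o]m+o≡n b<b'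
... | u , refl | v , refl = m+n≤o⇒m≤o _ (≤-reflexive (expand a b u v))
  where
    expand : ∀ a b u v → suc (a * (suc b + v) + (suc a + u) * b) + (u + v + u * v)
                         ≡ a * b + (suc a + u) * (suc b + v)
    expand = solve-∀

m^n*m^o*m≡m^[1+n+o] : ∀ m n o → m ^ n * m ^ o * m ≡ m ^ suc (n + o)
m^n*m^o*m≡m^[1+n+o] m n o = trans (*-comm (m ^ n * m ^ o) m) (cong (m *_) (sym (^-distribˡ-+-* m n o)))

module Construction (x : ℕ) .{{_ : NonZero x}} (G : ℕ) .{{_ : NonZero G}} where

  entry : ℕ → ℕ → ℕ
  entry i j = x ^ (G ^ i * 2 ^ j)

  entry-pos : ∀ i j → 1 ≤ entry i j
  entry-pos i j = m^n>0 x (G ^ i * 2 ^ j)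

  entry-dominant : 1 < G → ∀ {i i' j j'} → i < i' → j < j' →
    entry i j' * entry i' j * x ≤ entry i j * entry i' j'
  entry-dominant 1<G {i} {i'} {j} {j'} i<i' j<j' = begin
    entry i j' * entry i' j * x                ≡⟨ m^n*m^o*m≡m^[1+n+o] x (G ^ i * 2 ^ j') (G ^ i' * 2 ^ j) ⟩
    x ^ suc (G ^ i * 2 ^ j' + G ^ i' * 2 ^ j)  ≤⟨ ^-monoʳ-≤ x (rearrangement-< (^-monoʳ-< G 1<G i<i') (^-monoʳ-< 2 (s≤s (s≤s z≤n)) j<j')) ⟩
    x ^ (G ^ i * 2 ^ j + G ^ i' * 2 ^ j')      ≡⟨ ^-distribˡ-+-* x (G ^ i * 2 ^ j) (G ^ i' * 2 ^ j') ⟩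
    entry i j * entry i' j'                    ∎
    where open ≤-Reasoning

  submatrix-dominant : 1 < G → ∀ {k} {r c : Fin k → ℕ} → StrictInc r → StrictInc c →
    Dominant x (λ a b → entry (r a) (c b))
  submatrix-dominant 1<G r-inc c-inc a<a' b<b' = entry-dominant 1<G (r-inc _ _ a<a') (c-inc _ _ b<b')

  entry-increasing : 1 < x → ∀ i j → entry i j < entry i (suc j)
  entry-increasing 1<x i j =
    ^-monoʳ-< x 1<x (*-monoʳ-< (G ^ i) {{m^n≢0 G i}} (^-monoʳ-< 2 (s≤s (s≤s z≤n)) (n<1+n j)))

  entry-row-step : 1 < x → ∀ {m} → 2 ^ m < G → ∀ i → entry i m < entry (suc i) 1
  entry-row-step 1<x {m} 2^m<G i = ^-monoʳ-< x 1<x (begin-strict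
    G ^ i * 2 ^ m   <⟨ *-monoʳ-< (G ^ i) {{m^n≢0 G i}} 2^m<G ⟩
    G ^ i * G       ≡⟨ *-comm (G ^ i) G ⟩
    G * G ^ i       ≤⟨ m≤m*n (G * G ^ i) 2 ⟩
    G * G ^ i * 2   ∎)
    where open ≤-Reasoning

  entry-consecutive : ∀ i {j} → 2 ≤ j → entry i (j ∸ 1) * entry i j * x ≤ entry i (suc j)
  entry-consecutive i {suc zero}    (s≤s ())
  entry-consecutive i {suc (suc n)} _ = begin
    entry i (suc n) * entry i (suc (suc n)) * x ≡⟨ m^n*m^o*m≡m^[1+n+o] x e₁ e₂ ⟩
    x ^ suc (e₁ + e₂)                           ≤⟨ ^-monoʳ-≤ x (+-monoˡ-≤ (e₁ + e₂) e₁-pos) ⟩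
    x ^ (e₁ + (e₁ + e₂))                        ≡⟨ cong (x ^_) (doubling (G ^ i) (2 ^ n)) ⟩
    entry i (suc (suc (suc n)))                 ∎
    where
      open ≤-Reasoning
      e₁ = G ^ i * 2 ^ suc n
      e₂ = G ^ i * 2 ^ suc (suc n)
      e₁-pos : 1 ≤ e₁
      e₁-pos = *-mono-≤ (m^n>0 G i) (m^n>0 2 (suc n))
      doubling : ∀ g t → g * (2 * t) + (g * (2 * t) + g * (2 * (2 * t))) ≡ g * (2 * (2 * (2 * t)))
      doubling = solve-∀

theorem6p1 : (D m : ℕ) → 1 ≤ D → D < m → (ε : ℚ) → 0ℚ <ℚ ε →
    Σ (ℕ → ℕ → ℕ) (λ M →
    ((∀ i j → 1 ≤ i → i ≤ D → 1 ≤ j → j ≤ m → 1 ≤ M i j)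
    × (∀ i j → 1 ≤ i → i ≤ D → 1 ≤ j → j ≤ m ∸ 1 → M i j < M i (suc j))
    × (∀ i → 1 ≤ i → i ≤ D ∸ 1 → M i m < M (suc i) 1))
    × (∀ (k : ℕ) → 2 ≤ k → k ≤ D → (r c : Fin k → ℕ) →
    StrictInc r → StrictInc c →
    (∀ l → 1 ≤ r l × r l ≤ D) → (∀ l → 1 ≤ c l × c l ≤ m) →
    ∣ toℚ (det (λ x y → + M (r x) (c y))) - ℕtoℚ (prodFin (λ l → M (r l) (c l))) ∣
    <ℚ ε *ℚ ℕtoℚ (prodFin (λ l → M (r l) (c l))))
    × (∀ i j → 1 ≤ i → i ≤ D → 2 ≤ j → j ≤ m ∸ 1 →
    ℕtoℚ (M i (j ∸ 1) Data.Nat.* M i j) <ℚ ε *ℚ ℕtoℚ (M i (suc j))))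
theorem6p1 D m _ _ ε ε>0 =
  entry , ((λ i j _ _ _ _ → entry-pos i j) , (λ i j _ _ _ _ → entry-increasing 1<x i j)
          , (λ i _ _ → entry-row-step 1<x {m} ≤-refl i))
        , (λ k _ k≤D r c r-inc c-inc _ _ →
             det-near-diag-ℚ ε ε>0 (λ a b → entry (r a) (c b)) (submatrix-dominant G>1 r-inc c-inc)
               (s≤s (*-monoʳ-≤ q (≤-trans (slack-mono k≤D) (n≤1+n (slack D)))))
               (λ l → entry-pos (r l) (c l)))
        , (λ i j _ _ 2≤j _ →
             a*x≤b⇒a<ε*b ε ε>0 q<x (*-mono-≤ (entry-pos i (j ∸ 1)) (entry-pos i j)) (entry-consecutive i 2≤j))
  where
    q = ↧ₙ ε
    -- q < x and q · slack D < x are all that is asked of x.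
    x = suc (q * suc (slack D))
    1<x : 1 < x
    1<x = s≤s (s≤s z≤n)
    q<x : q < x
    q<x = s≤s (m≤m*n q (suc (slack D)))
    G>1 : 1 < suc (2 ^ m)
    G>1 = s≤s (m^n>0 2 m)
    open Construction x (suc (2 ^ m))
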